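{- The class of $K_{1,3}$-free graphs without a distance-$2$ packing of two cycles has unbounded tree-independence number.
   Context: Graphs are finite and simple. A graph is $K_{1,3}$-free if it has no induced subgraph isomorphic to $K_{1,3}$. A set $\mathcal{F}$ of cycles in $G$ is a distance-$2$ packing if any two distinct cycles of $\mathcal{F}$ have vertex sets at distance more than $2$ in $G$. A tree-decomposition of $G$ is a pair $(T,\beta)$ with $T$ a tree and $\beta:V(T)\to 2^{V(G)}$ such that every vertex lies in some bag, every edge has both ends in some bag, and for each vertex $v$ the nodes whose bags contain $v$ induce a subtree of $T$; its independence number is $\max_{u\in V(T)}\alpha(G[\beta(u)])$. The tree-independence number of $G$ is the minimum independence number over all tree-decompositions of $G$. -}

module Defs where

open import Data.Nat using (ℕ; zero; suc; _≤_)
open import Data.Fin using (Fin; zero; suc; inject₁; fromℕ)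
open import Data.Bool using (Bool; true; false)
open import Data.List using (List; length)
open import Data.List.Relation.Unary.All using (All)
open import Data.List.Relation.Unary.AllPairs using (AllPairs)
open import Data.Product using (Σ; ∃; _×_)
open import Data.Sum using (_⊎_)
open import Data.Unit using (⊤)
open import Data.Empty using (⊥)
open import Relation.Nullary using (¬_)
open import Relation.Binary.PropositionalEquality using (_≡_; _≢_)
open import Function.Definitions using (Injective)

record Graph (n : ℕ) : Set where
  field
    adj  : Fin n → Fin n → Bool
    sym  : ∀ u v → adj u v ≡ adj v u
    irr  : ∀ v → adj v v ≡ false

open Graph public

Edge : ∀ {n} → Graph n → Fin n → Fin n → Set
Edge G u v = adj G u v ≡ true

ClawFree : ∀ {n} → Graph n → Set
ClawFree {n} G = ∀ (c a b d : Fin n) →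
  Edge G c a → Edge G c b → Edge G c d →
  a ≢ b → a ≢ d → b ≢ d →
  ¬ Edge G a b → ¬ Edge G a d → ¬ Edge G b d → ⊥

record Cycle {n : ℕ} (G : Graph n) : Set where
  field
    len    : ℕ
    vtx    : Fin (suc (suc (suc len))) → Fin n
    inj    : Injective _≡_ _≡_ vtx
    adjStep : ∀ (i : Fin (suc (suc len))) → Edge G (vtx (inject₁ i)) (vtx (suc i))
    adjClose : Edge G (vtx (fromℕ (suc (suc len)))) (vtx zero)

open Cycle public

Near : ∀ {n} → Graph n → Fin n → Fin n → Set
Near G u w = u ≡ w ⊎ Edge G u w ⊎ ∃ (λ x → Edge G u x × Edge G x w)

FarApart : ∀ {n} {G : Graph n} → Cycle G → Cycle G → Set
FarApart {G = G} C D = ∀ i j → ¬ Near G (vtx C i) (vtx D j)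

-- G has a distance-2 packing of two cycles
-- (distance > 2 already forces the two cycles to be distinct)
HasDist2PackingOfTwoCycles : ∀ {n} → Graph n → Set
HasDist2PackingOfTwoCycles G = Σ (Cycle G) λ C → Σ (Cycle G) λ D → FarApart C D

data Walk {n : ℕ} (G : Graph n) (P : Fin n → Set) : Fin n → Fin n → Set where
  here : ∀ {u} → P u → Walk G P u u
  step : ∀ {u w v} → P u → Edge G u w → Walk G P w v → Walk G P u v

Connected : ∀ {n} → Graph n → Set
Connected {n} G = ∀ (u v : Fin n) → Walk G (λ _ → ⊤) u v

IsTree : ∀ {m} → Graph (suc m) → Set
IsTree T = Connected T × ¬ Cycle T

record TreeDecomposition {n : ℕ} (G : Graph n) : Set where
  field
    nodes   : ℕ
    T       : Graph (suc nodes)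
    isTree  : IsTree T
    bag     : Fin (suc nodes) → Fin n → Bool
    cover   : ∀ v → ∃ λ t → bag t v ≡ true
    edgeIn  : ∀ u v → Edge G u v → ∃ λ t → bag t u ≡ true × bag t v ≡ true
    subtree : ∀ v t t' → bag t v ≡ true → bag t' v ≡ true →
              Walk T (λ s → bag s v ≡ true) t t'

open TreeDecomposition public

IndependentIn : ∀ {n} → Graph n → (Fin n → Bool) → List (Fin n) → Set
IndependentIn G B xs =
  AllPairs _≢_ xs × All (λ v → B v ≡ true) xs × AllPairs (λ u v → ¬ Edge G u v) xs

IndepNumberAtMost : ∀ {n} → Graph n → (Fin n → Bool) → ℕ → Set
IndepNumberAtMost G B k = ∀ xs → IndependentIn G B xs → length xs ≤ k

TreeIndepNumberAtMost : ∀ {n} → Graph n → ℕ → Set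
TreeIndepNumberAtMost G k =
  Σ (TreeDecomposition G) λ D → ∀ t → IndepNumberAtMost G (bag D t) k

{-# OPTIONS --safe #-}
module Submission where

open import Defs
open import Data.Nat using (ℕ; zero; suc; _≤_; _<_; _+_; _*_; z≤n; s≤s)
open import Data.Nat.Properties
  using (≤-refl; ≤-trans; <-≤-trans; ≤-<-trans; m≤n⇒m≤1+n; +-identityʳ; +-suc; +-mono-≤;
         1+n≰n; n<1+n)
open import Data.Fin using (Fin; zero; suc; toℕ; combine; remQuot; _≟_)
open import Data.Fin.Properties
  using (any?; pigeonhole; toℕ-injective; toℕ-inject₁; toℕ-fromℕ; toℕ<n; toℕ≤pred[n];
         remQuot-combine; combine-remQuot)
  renaming (<⇒≢ to <⇒≢ᶠ)
open import Data.Fin.Subset using (Subset; ⊤; _∈_; _-_; _⊂_)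
open import Data.Fin.Subset.Properties using (_∈?_; ∈⊤; x∈p⇒p-x⊂p; x∈p∧x≢y⇒x∈p-y)
open import Data.Fin.Subset.Induction using (⊂-wellFounded)
open import Induction.WellFounded using (Acc; acc)
open import Data.Bool using (Bool; true; _xor_)
import Data.Bool as Bool
open import Data.List using (List; []; _∷_; length; map; _++_; lookup)
open import Data.List.Properties using (length-map; length-++)
open import Data.List.Membership.Propositional using (_∉_)
open import Data.List.Membership.Propositional.Properties using (∈-++⁺ˡ; ∈-++⁺ʳ)
open import Data.List.Relation.Unary.Any using (Any; index)
open import Data.List.Relation.Unary.Any.Properties using (lookup-index)
open import Data.List.Relation.Unary.All using (All; []; _∷_)
import Data.List.Relation.Unary.All as All
open import Data.List.Relation.Unary.All.Properties using (¬Any⇒All¬; map⁻)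
open import Data.List.Relation.Unary.AllPairs using ([]; _∷_)
open import Data.Product using (Σ; ∃; _×_; _,_; proj₁; proj₂)
open import Data.Sum using (_⊎_; inj₁; inj₂; [_,_]′)
open import Data.Empty using (⊥-elim)
open import Function using (_∘_)
open import Relation.Nullary using (¬_; Dec; yes; no; does)
open import Relation.Nullary.Decidable using (_×-dec_; ¬?; decidable-stable; dec-true; dec-false)
open import Relation.Unary using (Decidable)
open import Relation.Binary.PropositionalEquality using (_≡_; _≢_; refl; cong; cong₂; subst)
import Relation.Binary.PropositionalEquality as ≡
open ≡.≡-Reasoning

-- The witness is the rook's graph on a (2k+1) × (2k+1) board: it is claw-free since the
-- neighbourhood of a square is covered by two cliques (its row and its column), and it has
-- diameter 2, so no two cycles are more than distance 2 apart. For each placement of at most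
-- k rooks the squares they leave unattacked form a connected set, and any two such sets meet,
-- because 2k rows (columns) leave one free. In a tree decomposition the bags meeting one such
-- set form a subtree; these subtrees pairwise intersect, so by the Helly property of subtrees
-- of a tree (proved by deleting leaves) a single bag meets all of the sets. Placing rooks
-- greedily inside that bag gives k + 1 pairwise non-attacking squares, an independent set.

module _ {n : ℕ} (G : Graph n) where

  Edge-sym : ∀ {u v} → Edge G u v → Edge G v u
  Edge-sym {u} {v} e = ≡.trans (Graph.sym G v u) e

  Edge⇒≢ : ∀ {u v} → Edge G u v → u ≢ v
  Edge⇒≢ {u} e refl with ≡.trans (≡.sym e) (irr G u)
  ... | ()

  Edge? : ∀ u v → Dec (Edge G u v)
  Edge? u v = adj G u v Bool.≟ true

  ConnectedSet : (Fin n → Set) → Set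
  ConnectedSet P = ∀ {x y} → P x → P y → Walk G P x y

module _ {n : ℕ} {G : Graph n} where

  mapʷ : ∀ {P Q : Fin n → Set} → (∀ {t} → P t → Q t) → ∀ {u v} → Walk G P u v → Walk G Q u v
  mapʷ f (here p)     = here (f p)
  mapʷ f (step p e w) = step (f p) e (mapʷ f w)

  _++ʷ_ : ∀ {P : Fin n → Set} {u v w} → Walk G P u v → Walk G P v w → Walk G P u w
  here _     ++ʷ q = q
  step p e w ++ʷ q = step p e (w ++ʷ q)

  headʷ : ∀ {P : Fin n → Set} {u v} → Walk G P u v → P u
  headʷ (here p)     = p
  headʷ (step p _ _) = p

  ≡⊎Edge⇒Walk : ∀ {P : Fin n → Set} {u v} → P u → P v → u ≡ v ⊎ Edge G u v → Walk G P u v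
  ≡⊎Edge⇒Walk pu pv (inj₁ refl) = here pu
  ≡⊎Edge⇒Walk pu pv (inj₂ e)    = step pu e (here pv)

_∖_ : ∀ {A : Set} → (A → Set) → A → A → Set
(P ∖ a) x = P x × x ≢ a

IsLeafOf : ∀ {N} → Graph N → (Fin N → Set) → Fin N → Set
IsLeafOf T U ℓ = U ℓ × (∀ {w w′} → U w → U w′ → Edge T ℓ w → Edge T ℓ w′ → w ≡ w′)

module LeafSearch {N : ℕ} (T : Graph N) (acyclic : ¬ Cycle T)
                  {U : Fin N → Set} (U? : Decidable U) where

  -- vertex 0 is the moving end of the path and vertex j its start; values beyond j are junk.
  record SimplePath (j : ℕ) : Set where
    field
      vertex    : ℕ → Fin N
      injective : ∀ {a b} → a ≤ j → b ≤ j → vertex a ≡ vertex b → a ≡ b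
      within    : ∀ {a} → a ≤ j → U (vertex a)
      linked    : ∀ {a} → a < j → Edge T (vertex a) (vertex (suc a))

  open SimplePath

  single : ∀ {v} → U v → SimplePath 0
  single {v} uv = record
    { vertex    = λ _ → v
    ; injective = λ { z≤n z≤n _ → refl }
    ; within    = λ { z≤n → uv }
    ; linked    = λ ()
    }

  shorter-than-order : ∀ {j} → SimplePath j → ¬ (N ≤ j)
  shorter-than-order p N≤j with pigeonhole (s≤s N≤j) (vertex p ∘ toℕ)
  ... | a , b , a<b , same =
    <⇒≢ᶠ a<b (toℕ-injective (injective p (toℕ≤pred[n] a) (toℕ≤pred[n] b) same))

  closing-edge⇒cycle : ∀ {j} (p : SimplePath j) (len : ℕ) → 2 + len ≤ j →
                       Edge T (vertex p (2 + len)) (vertex p 0) → Cycle T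
  closing-edge⇒cycle {j} p len 2+len≤j e = record
    { len      = len
    ; vtx      = vertex p ∘ toℕ
    ; inj      = λ {i} {i′} same → toℕ-injective (injective p (bound i) (bound i′) same)
    ; adjStep  = λ i → subst (λ a → Edge T (vertex p a) (vertex p (suc (toℕ i))))
                             (≡.sym (toℕ-inject₁ i)) (linked p (<-≤-trans (toℕ<n i) 2+len≤j))
    ; adjClose = subst (λ a → Edge T (vertex p a) (vertex p 0)) (≡.sym (toℕ-fromℕ (2 + len))) e
    }
    where
    bound : (i : Fin (3 + len)) → toℕ i ≤ j
    bound i = ≤-trans (toℕ≤pred[n] i) 2+len≤j

  fresh-neighbour : ∀ {j w} (p : SimplePath j) → Edge T (vertex p 0) w → w ≢ vertex p 1 →
                    ∀ {a} → a ≤ j → vertex p a ≢ w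
  fresh-neighbour p e w≢p₁ {zero}          _     p₀≡w = Edge⇒≢ T e p₀≡w
  fresh-neighbour p e w≢p₁ {suc zero}      _     p₁≡w = w≢p₁ (≡.sym p₁≡w)
  fresh-neighbour p e w≢p₁ {suc (suc len)} a≤j   pₐ≡w =
    acyclic (closing-edge⇒cycle p len a≤j
              (subst (λ x → Edge T x (vertex p 0)) (≡.sym pₐ≡w) (Edge-sym T e)))

  extend : ∀ {j w} (p : SimplePath j) → U w → Edge T (vertex p 0) w →
           (∀ {a} → a ≤ j → vertex p a ≢ w) → SimplePath (suc j)
  extend {j} {w} p uw e fresh = record
    { vertex = vertex′ ; injective = injective′ ; within = within′ ; linked = linked′ }
    where
    vertex′ : ℕ → Fin N
    vertex′ zero    = w
    vertex′ (suc a) = vertex p a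

    injective′ : ∀ {a b} → a ≤ suc j → b ≤ suc j → vertex′ a ≡ vertex′ b → a ≡ b
    injective′ {zero}  {zero}  _         _         _    = refl
    injective′ {zero}  {suc b} _         (s≤s b≤j) same = ⊥-elim (fresh b≤j (≡.sym same))
    injective′ {suc a} {zero}  (s≤s a≤j) _         same = ⊥-elim (fresh a≤j same)
    injective′ {suc a} {suc b} (s≤s a≤j) (s≤s b≤j) same = cong suc (injective p a≤j b≤j same)

    within′ : ∀ {a} → a ≤ suc j → U (vertex′ a)
    within′ {zero}  _         = uw
    within′ {suc a} (s≤s a≤j) = within p a≤j

    linked′ : ∀ {a} → a < suc j → Edge T (vertex′ a) (vertex′ (suc a))
    linked′ {zero}  _         = Edge-sym T e
    linked′ {suc a} (s≤s a<j) = linked p a<j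

  -- The end is a leaf once its only neighbour in U is the previous vertex. For the single path
  -- vertex 1 is the junk value vertex 0, which is no neighbour, so no case split on j is needed.
  grow : ∀ {j} (fuel : ℕ) → SimplePath j → N ≤ j + fuel → ∃ (IsLeafOf T U)
  grow {j} zero p N≤j = ⊥-elim (shorter-than-order p (subst (N ≤_) (+-identityʳ j) N≤j))
  grow {j} (suc fuel) p N≤j+1+fuel
    with any? (λ w → U? w ×-dec Edge? T (vertex p 0) w ×-dec ¬? (w ≟ vertex p 1))
  ... | yes (w , uw , e , w≢p₁) =
    grow fuel (extend p uw e (fresh-neighbour p e w≢p₁)) (subst (N ≤_) (+-suc j fuel) N≤j+1+fuel)
  ... | no none =
    vertex p 0 , within p z≤n , λ uw uw′ e e′ → ≡.trans (back uw e) (≡.sym (back uw′ e′))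
    where
    back : ∀ {w} → U w → Edge T (vertex p 0) w → w ≡ vertex p 1
    back {w} uw e = decidable-stable (w ≟ vertex p 1) (λ w≢p₁ → none (w , uw , e , w≢p₁))

  leaf-exists : ∀ {v} → U v → ∃ (IsLeafOf T U)
  leaf-exists uv = grow N (single uv) ≤-refl

module LeafRemoval {N : ℕ} (T : Graph N) {U : Fin N → Set} {ℓ : Fin N} (leaf : IsLeafOf T U ℓ) where

  -- A walk entering the leaf must leave it towards the same neighbour, so the detour can be cut.
  avoid-leaf : ∀ {P} → (∀ {t} → P t → U t) → ∀ {x y} → Walk T P x y → x ≢ ℓ → y ≢ ℓ →
               Walk T (P ∖ ℓ) x y
  avoid-leaf P⊆U (here px) x≢ℓ y≢ℓ = here (px , x≢ℓ)
  avoid-leaf {P} P⊆U (step {u = x} {w = w} px e W) x≢ℓ y≢ℓ with w ≟ ℓ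
  ... | no w≢ℓ = step (px , x≢ℓ) e (avoid-leaf P⊆U W w≢ℓ y≢ℓ)
  ... | yes refl with W
  ...   | here _ = ⊥-elim (y≢ℓ refl)
  ...   | step {w = z} _ e′ W′ =
    subst (λ a → Walk T (P ∖ ℓ) a _) z≡x
      (avoid-leaf P⊆U W′ (λ z≡ℓ → x≢ℓ (≡.trans (≡.sym z≡x) z≡ℓ)) y≢ℓ)
    where
    z≡x : z ≡ x
    z≡x = proj₂ leaf (P⊆U (headʷ W′)) (P⊆U px) e′ (Edge-sym T e)

  connected-∖-leaf : ∀ {P} → (∀ {t} → P t → U t) → ConnectedSet T P → ConnectedSet T (P ∖ ℓ)
  connected-∖-leaf P⊆U connected (px , x≢ℓ) (py , y≢ℓ) = avoid-leaf P⊆U (connected px py) x≢ℓ y≢ℓ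

  neighbour-of-leaf : ∀ {P t} → ConnectedSet T P → P ℓ → P t → t ≢ ℓ → ∃ λ w → P w × Edge T ℓ w
  neighbour-of-leaf connected pℓ pt t≢ℓ with connected pℓ pt
  ... | here _     = ⊥-elim (t≢ℓ refl)
  ... | step _ e W = _ , headʷ W , e

  -- If P and Q meet only in the leaf, both contain its unique neighbour in U.
  meet-∖-leaf : ∀ {P Q} → (∀ {t} → P t → U t) → (∀ {t} → Q t → U t) →
                ConnectedSet T P → ConnectedSet T Q →
                ∃ (P ∖ ℓ) → ∃ (Q ∖ ℓ) → ∃ (λ t → P t × Q t) → ∃ λ t → (P ∖ ℓ) t × (Q ∖ ℓ) t
  meet-∖-leaf P⊆U Q⊆U P-connected Q-connected (_ , p , p≢ℓ) (_ , q , q≢ℓ) (t , pt , qt) with t ≟ ℓ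
  ... | no t≢ℓ = t , (pt , t≢ℓ) , (qt , t≢ℓ)
  ... | yes refl
    with neighbour-of-leaf P-connected pt p p≢ℓ | neighbour-of-leaf Q-connected qt q q≢ℓ
  ... | w , pw , e | w′ , qw′ , e′ = w , (pw , w≢ℓ) , (subst _ (≡.sym w≡w′) qw′ , w≢ℓ)
    where
    w≡w′ : w ≡ w′
    w≡w′ = proj₂ leaf (P⊆U pw) (Q⊆U qw′) e e′
    w≢ℓ : w ≢ ℓ
    w≢ℓ = Edge⇒≢ T e ∘ ≡.sym

module _ {N : ℕ} (T : Graph (suc N)) (acyclic : ¬ Cycle T) where

  helly-within : {I : Set} (S : I → Fin (suc N) → Set) → (∀ i → Decidable (S i)) →
                 (∀ i → ConnectedSet T (S i)) → (∀ i j → ∃ λ t → S i t × S j t) →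
                 (U : Subset (suc N)) → Acc _⊂_ U → (∀ i {t} → S i t → t ∈ U) →
                 ¬ ¬ ∃ λ t → ∀ i → S i t
  helly-within S S? connected meet U (acc smaller) S⊆U no-common with any? (_∈? U)
  ... | no empty = no-common (zero , λ i → ⊥-elim (empty (_ , S⊆U i (proj₁ (proj₂ (meet i i))))))
  ... | yes (_ , u∈U) with LeafSearch.leaf-exists T acyclic (_∈? U) u∈U
  ... | ℓ , leaf =
    helly-within (λ i → S i ∖ ℓ) (λ i t → S? i t ×-dec ¬? (t ≟ ℓ))
      (λ i → connected-∖-leaf (S⊆U i) (connected i))
      (λ i j → meet-∖-leaf (S⊆U i) (S⊆U j) (connected i) (connected j)
                           (escapes i) (escapes j) (meet i j))
      (U - ℓ) (smaller (x∈p⇒p-x⊂p (proj₁ leaf)))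
      (λ i (s , t≢ℓ) → x∈p∧x≢y⇒x∈p-y (S⊆U i s) t≢ℓ)
      (λ (t , common) → no-common (t , λ i → proj₁ (common i)))
    where
    open LeafRemoval T leaf

    -- An S i inside {ℓ} would put ℓ in every S j, since S j meets S i.
    escapes : ∀ i → ∃ (S i ∖ ℓ)
    escapes i with any? (λ t → S? i t ×-dec ¬? (t ≟ ℓ))
    ... | yes found = found
    ... | no none = ⊥-elim (no-common (ℓ , λ j → in-S j (meet i j)))
      where
      in-S : ∀ j → ∃ (λ t → S i t × S j t) → S j ℓ
      in-S j (t , sᵢ , sⱼ) = subst (S j) (decidable-stable (t ≟ ℓ) (λ t≢ℓ → none (t , sᵢ , t≢ℓ))) sⱼ

  helly : {I : Set} (S : I → Fin (suc N) → Set) → (∀ i → Decidable (S i)) →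
          (∀ i → ConnectedSet T (S i)) → (∀ i j → ∃ λ t → S i t × S j t) →
          ¬ ¬ ∃ λ t → ∀ i → S i t
  helly S S? connected meet = helly-within S S? connected meet ⊤ (⊂-wellFounded ⊤) (λ _ _ → ∈⊤)

Meets : ∀ {n} → (Fin n → Bool) → (Fin n → Set) → Set
Meets B X = ∃ λ v → X v × B v ≡ true

module _ {n : ℕ} {G : Graph n} (D : TreeDecomposition G) where

  -- Consecutive vertices of a walk share a bag, and the bags containing a vertex form a subtree.
  lift-walk : ∀ {X v v′} → Walk G X v v′ → ∀ {t t′} → bag D t v ≡ true → bag D t′ v′ ≡ true →
              Walk (T D) (λ s → Meets (bag D s) X) t t′
  lift-walk (here xv) {t} {t′} bt bt′ = mapʷ (λ b → _ , xv , b) (subtree D _ t t′ bt bt′)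
  lift-walk (step {v} {w} xv e W) {t} bt bt′ with edgeIn D v w e
  ... | s , bsv , bsw = mapʷ (λ b → v , xv , b) (subtree D v t s bt bsv) ++ʷ lift-walk W bsw bt′

  bags-meeting-connected : ∀ {X} → ConnectedSet G X → ConnectedSet (T D) (λ t → Meets (bag D t) X)
  bags-meeting-connected connected (v , xv , bv) (v′ , xv′ , bv′) =
    lift-walk (connected xv xv′) bv bv′

  bag-meeting-both : ∀ {X Y} → ∃ (λ v → X v × Y v) → ∃ λ t → Meets (bag D t) X × Meets (bag D t) Y
  bag-meeting-both (v , xv , yv) with cover D v
  ... | t , bv = t , (v , xv , bv) , (v , yv , bv)

  bag-meeting-all : {I : Set} (X : I → Fin n → Set) → (∀ i → Decidable (X i)) →
                    (∀ i → ConnectedSet G (X i)) → (∀ i j → ∃ λ v → X i v × X j v) →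
                    ¬ ¬ ∃ λ t → ∀ i → Meets (bag D t) (X i)
  bag-meeting-all X X? connected meet =
    helly (T D) (proj₂ (isTree D)) (λ i t → Meets (bag D t) (X i))
      (λ i t → any? (λ v → X? i v ×-dec (bag D t v Bool.≟ true)))
      (λ i → bags-meeting-connected (connected i))
      (λ i j → bag-meeting-both (meet i j))

module _ {n : ℕ} where
  open import Data.List.Membership.DecPropositional (_≟_ {n = n}) using () renaming (_∈?_ to _∈ₗ?_)

  covering-list-long : (L : List (Fin n)) → (∀ r → Any (r ≡_) L) → ¬ (length L < n)
  covering-list-long L position short with pigeonhole short (index ∘ position)
  ... | a , b , a<b , same =
    <⇒≢ᶠ a<b (begin
      a                              ≡⟨ lookup-index (position a) ⟩
      lookup L (index (position a))  ≡⟨ cong (lookup L) same ⟩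
      lookup L (index (position b))  ≡⟨ lookup-index (position b) ⟨
      b                              ∎)

  ∃-∉-short-list : (L : List (Fin n)) → length L < n → ∃ λ r → r ∉ L
  ∃-∉-short-list L short with any? (λ r → ¬? (r ∈ₗ? L))
  ... | yes missing = missing
  ... | no none = ⊥-elim (covering-list-long L position short)
    where
    position : ∀ r → Any (r ≡_) L
    position r = decidable-stable (r ∈ₗ? L) (λ r∉L → none (r , r∉L))

does-sym : ∀ {n} (a b : Fin n) → does (a ≟ b) ≡ does (b ≟ a)
does-sym a b with a ≟ b
... | yes a≡b = ≡.sym (dec-true (b ≟ a) (≡.sym a≡b))
... | no a≢b  = ≡.sym (dec-false (b ≟ a) (a≢b ∘ ≡.sym))

module Rook (M : ℕ) where

  Square : Set
  Square = Fin (M * M)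

  row : Square → Fin M
  row v = proj₁ (remQuot {M} M v)

  col : Square → Fin M
  col v = proj₂ (remQuot {M} M v)

  square : Fin M → Fin M → Square
  square = combine

  row-square : ∀ r c → row (square r c) ≡ r
  row-square r c = cong proj₁ (remQuot-combine r c)

  col-square : ∀ r c → col (square r c) ≡ c
  col-square r c = cong proj₂ (remQuot-combine r c)

  square-ext : ∀ {u v} → row u ≡ row v → col u ≡ col v → u ≡ v
  square-ext {u} {v} r≡ c≡ = begin
    u                       ≡⟨ combine-remQuot {M} M u ⟨
    square (row u) (col u)  ≡⟨ cong₂ square r≡ c≡ ⟩
    square (row v) (col v)  ≡⟨ combine-remQuot {M} M v ⟩
    v                       ∎

  rook : Graph (M * M)
  rook = record
    { adj = λ u v → does (row u ≟ row v) xor does (col u ≟ col v)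
    ; sym = λ u v → cong₂ _xor_ (does-sym (row u) (row v)) (does-sym (col u) (col v))
    ; irr = λ v → cong₂ _xor_ (dec-true (row v ≟ row v) refl) (dec-true (col v ≟ col v) refl)
    }

  Attack : Square → Square → Set
  Attack u v = row u ≡ row v ⊎ col u ≡ col v

  Edge⇒Attack : ∀ {u v} → Edge rook u v → Attack u v
  Edge⇒Attack {u} {v} e with row u ≟ row v | col u ≟ col v
  ... | yes r≡ | _     = inj₁ r≡
  ... | no _   | yes c≡ = inj₂ c≡
  Edge⇒Attack () | no _ | no _

  same-row⇒Edge : ∀ {u v} → row u ≡ row v → u ≢ v → Edge rook u v
  same-row⇒Edge {u} {v} r≡ u≢v =
    cong₂ _xor_ (dec-true (row u ≟ row v) r≡) (dec-false (col u ≟ col v) (u≢v ∘ square-ext r≡))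

  same-col⇒Edge : ∀ {u v} → col u ≡ col v → u ≢ v → Edge rook u v
  same-col⇒Edge {u} {v} c≡ u≢v =
    cong₂ _xor_ (dec-false (row u ≟ row v) (λ r≡ → u≢v (square-ext r≡ c≡)))
                (dec-true (col u ≟ col v) c≡)

  Attack⇒≡⊎Edge : ∀ {u v} → Attack u v → u ≡ v ⊎ Edge rook u v
  Attack⇒≡⊎Edge {u} {v} attack with u ≟ v
  ... | yes u≡v = inj₁ u≡v
  ... | no u≢v  = inj₂ ([ (λ r≡ → same-row⇒Edge r≡ u≢v) , (λ c≡ → same-col⇒Edge c≡ u≢v) ]′ attack)

  rook-clawFree : ClawFree rook
  rook-clawFree c a b d ca cb cd a≢b a≢d b≢d ¬ab ¬ad ¬bd
    with Edge⇒Attack {c} {a} ca | Edge⇒Attack {c} {b} cb | Edge⇒Attack {c} {d} cd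
  ... | inj₁ ra | inj₁ rb | _       = ¬ab (same-row⇒Edge (≡.trans (≡.sym ra) rb) a≢b)
  ... | inj₂ ca | inj₂ cb | _       = ¬ab (same-col⇒Edge (≡.trans (≡.sym ca) cb) a≢b)
  ... | inj₁ ra | _       | inj₁ rd = ¬ad (same-row⇒Edge (≡.trans (≡.sym ra) rd) a≢d)
  ... | inj₂ ca | _       | inj₂ cd = ¬ad (same-col⇒Edge (≡.trans (≡.sym ca) cd) a≢d)
  ... | _       | inj₁ rb | inj₁ rd = ¬bd (same-row⇒Edge (≡.trans (≡.sym rb) rd) b≢d)
  ... | _       | inj₂ cb | inj₂ cd = ¬bd (same-col⇒Edge (≡.trans (≡.sym cb) cd) b≢d)

  corner : Square → Square → Square
  corner u w = square (row u) (col w)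

  Attack-corner : ∀ u w → Attack u (corner u w)
  Attack-corner u w = inj₁ (≡.sym (row-square (row u) (col w)))

  corner-Attack : ∀ u w → Attack (corner u w) w
  corner-Attack u w = inj₂ (col-square (row u) (col w))

  rook-near : ∀ u w → Near rook u w
  rook-near u w with Attack⇒≡⊎Edge (Attack-corner u w) | Attack⇒≡⊎Edge (corner-Attack u w)
  ... | inj₁ u≡x | inj₁ x≡w = inj₁ (≡.trans u≡x x≡w)
  ... | inj₁ u≡x | inj₂ xw  = inj₂ (inj₁ (subst (λ x → Edge rook x w) (≡.sym u≡x) xw))
  ... | inj₂ ux  | inj₁ x≡w = inj₂ (inj₁ (subst (Edge rook u) x≡w ux))
  ... | inj₂ ux  | inj₂ xw  = inj₂ (inj₂ (corner u w , ux , xw))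

  rook-no-packing : ¬ HasDist2PackingOfTwoCycles rook
  rook-no-packing (_ , _ , far) = far zero zero (rook-near _ _)

  Unattacked : List Square → Square → Set
  Unattacked P v = row v ∉ map row P × col v ∉ map col P

  unattacked? : ∀ P → Decidable (Unattacked P)
  unattacked? P v = ¬? (row v ∈ₗ? map row P) ×-dec ¬? (col v ∈ₗ? map col P)
    where
    open import Data.List.Membership.DecPropositional (_≟_ {n = M})
      using () renaming (_∈?_ to _∈ₗ?_)

  unattacked-square : ∀ {P r c} → r ∉ map row P → c ∉ map col P → Unattacked P (square r c)
  unattacked-square {P} {r} {c} r∉ c∉ =
    subst (_∉ map row P) (≡.sym (row-square r c)) r∉ ,
    subst (_∉ map col P) (≡.sym (col-square r c)) c∉

  unattacked-connected : ∀ P → ConnectedSet rook (Unattacked P)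
  unattacked-connected P {u} {w} (ru , cu) (rw , cw) =
    ≡⊎Edge⇒Walk (ru , cu) x-free (Attack⇒≡⊎Edge (Attack-corner u w))
    ++ʷ ≡⊎Edge⇒Walk x-free (rw , cw) (Attack⇒≡⊎Edge (corner-Attack u w))
    where
    x-free : Unattacked P (corner u w)
    x-free = unattacked-square ru cw

  unattacked-meet : ∀ P P′ → length P + length P′ < M → ∃ λ v → Unattacked P v × Unattacked P′ v
  unattacked-meet P P′ short
    with ∃-∉-short-list (map row P ++ map row P′) (fits row)
       | ∃-∉-short-list (map col P ++ map col P′) (fits col)
    where
    fits : (f : Square → Fin M) → length (map f P ++ map f P′) < M
    fits f = subst (_< M) (≡.sym (begin
      length (map f P ++ map f P′)          ≡⟨ length-++ (map f P) ⟩
      length (map f P) + length (map f P′)  ≡⟨ cong₂ _+_ (length-map f P) (length-map f P′) ⟩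
      length P + length P′                  ∎)) short
  ... | r , r∉ | c , c∉ =
    square r c ,
    unattacked-square (r∉ ∘ ∈-++⁺ˡ) (c∉ ∘ ∈-++⁺ˡ) ,
    unattacked-square (r∉ ∘ ∈-++⁺ʳ _) (c∉ ∘ ∈-++⁺ʳ _)

  extend-independent : ∀ {B P x} → IndependentIn rook B P → Unattacked P x → B x ≡ true →
                       IndependentIn rook B (x ∷ P)
  extend-independent {P = P} {x} (distinct , inside , nonadjacent) (r∉ , c∉) bx =
    All.map (λ r≢ → r≢ ∘ cong row) rows ∷ distinct ,
    bx ∷ inside ,
    All.zipWith (λ (r≢ , c≢) e → [ r≢ , c≢ ]′ (Edge⇒Attack e)) (rows , cols) ∷ nonadjacent
    where
    rows : All (λ p → row x ≢ row p) P
    rows = map⁻ (¬Any⇒All¬ (map row P) r∉)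
    cols : All (λ p → col x ≢ col p) P
    cols = map⁻ (¬Any⇒All¬ (map col P) c∉)

  independent-of-size : ∀ {B k} → (∀ P → length P ≤ k → Meets B (Unattacked P)) →
                        ∀ m → m ≤ suc k → ∃ λ P → IndependentIn rook B P × length P ≡ m
  independent-of-size hit zero    _         = [] , ([] , [] , []) , refl
  independent-of-size hit (suc m) (s≤s m≤k) with independent-of-size hit m (m≤n⇒m≤1+n m≤k)
  ... | P , independent , refl with hit P m≤k
  ... | x , x-free , bx = x ∷ P , extend-independent independent x-free bx , refl

  rook-treeIndepNumber> : ∀ {k} → k + k < M → ¬ TreeIndepNumberAtMost rook k
  rook-treeIndepNumber> {k} 2k<M (D , α≤k) =
    bag-meeting-all D X (λ (P , _) → unattacked? P)
      (λ (P , _) → unattacked-connected P)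
      (λ (P , ≤k) (P′ , ≤k′) → unattacked-meet P P′ (≤-<-trans (+-mono-≤ ≤k ≤k′) 2k<M))
      λ (t , hit) → too-large t hit
    where
    X : (Σ (List Square) λ P → length P ≤ k) → Square → Set
    X (P , _) = Unattacked P
    too-large : ∀ t → ¬ (∀ i → Meets (bag D t) (X i))
    too-large t hit with independent-of-size (λ P ≤k → hit (P , ≤k)) (suc k) ≤-refl
    ... | P , independent , |P|≡1+k = 1+n≰n (subst (_≤ k) |P|≡1+k (α≤k t P independent))

theorem1p8 : ∀ (k : ℕ) → Σ ℕ λ n → Σ (Graph n) λ G →
    ClawFree G × ¬ HasDist2PackingOfTwoCycles G × ¬ TreeIndepNumberAtMost G k
theorem1p8 k =
  M * M , rook , rook-clawFree , rook-no-packing , rook-treeIndepNumber> (n<1+n (k + k))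
  where
  M : ℕ
  M = suc (k + k)
  open Rook M
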